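{- Let $D$ be a positive integer which is not a sum of two squares of integers, and let $\mathcal{C}$ be one of the following circles in $\mathbb{C}$: $\mathcal{C}_D: |z|^2-D=0$; $\mathcal{C}_{D,1}: 2|z|^2+z+\bar z-\frac{D-1}{2}=0$ (when $D\equiv1\pmod4$); $\mathcal{C}_{D,2}: 2|z|^2+iz-i\bar z-\frac{D-1}{2}=0$ (when $D\equiv1\pmod4$); $\mathcal{C}_{D,3}: 2|z|^2+(1+i)z+(1-i)\bar z-\frac{D-2}{2}=0$ (when $D\equiv2\pmod4$). Then $\begin{pmatrix}1&1\\0&1\end{pmatrix}\mathcal{C}\cap\mathcal{C}$ is nontrivial, i.e. the translate $\mathcal{C}+1$ crosses $\mathcal{C}$. -}

module Defs where

open import Data.Nat as ℕ using (ℕ; _%_)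
open import Data.Integer as ℤ using (ℤ; +_)
open import Data.Rational using (ℚ; _/_; _+_; _*_; _-_; -_; _÷_; _<_; 0ℚ; 1ℚ; NonZero)
open import Data.Product using (∃-syntax)
open import Relation.Binary.PropositionalEquality using (_≡_)
open import Relation.Nullary using (¬_)

record ℚ[i] : Set where
  constructor _+i_
  field
    re : ℚ
    im : ℚ
open ℚ[i] public

_-ᶜ_ : ℚ[i] → ℚ[i] → ℚ[i]
(x +i y) -ᶜ (u +i v) = (x - u) +i (y - v)

normSq : ℚ[i] → ℚ
normSq (x +i y) = x * x + y * y

-- A circle in ℂ given by the Hermitian equation
--   a |z|^2 + b z + conj(b) conj(z) + c = 0 ,   a, c ∈ ℚ, a ≠ 0, b ∈ ℚ(i).
record Circle : Set where
  constructor circle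
  field
    a   : ℚ
    b   : ℚ[i]
    c   : ℚ
    {{a≢0}} : NonZero a
open Circle public

-- Completing the square: a |z + conj(b)/a|^2 = |b|^2/a - c, so
-- centre = - conj(b) / a and squared radius = (|b|^2 - a c) / a^2.
centre : Circle → ℚ[i]
centre C = (- (re (b C) ÷ a C)) +i (im (b C) ÷ a C)

radiusSq : Circle → ℚ
radiusSq C = ((normSq (b C) - a C * c C) ÷ a C) ÷ a C

-- Image of a circle under the Möbius map of (1 1; 0 1), i.e. z ↦ z + 1:
-- w lies on the image iff w - 1 lies on C; expanding
--   a|w-1|^2 + b(w-1) + conj(b)(conj w - 1) + c
--     = a|w|^2 + (b - a) w + conj(b - a) conj w + (c + a - 2 Re b).
translate1 : Circle → Circle
translate1 (circle a (x +i y) c) = circle a ((x - a) +i y) (c + a - (x + x))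

-- Two circles (of positive radius) cross, i.e. meet in exactly two points,
-- iff with d = distance of centres, |r - s| < d < r + s, equivalently
-- (d^2 - r^2 - s^2)^2 < 4 r^2 s^2.
Crosses : Circle → Circle → Set
Crosses C C' =
  (0ℚ < R) × (0ℚ < S) ×
  ((d2 - R - S) * (d2 - R - S) < ((+ 4) / 1) * R * S)
  where
    open import Data.Product using (_×_)
    R  = radiusSq C
    S  = radiusSq C'
    d2 = normSq (centre C -ᶜ centre C')

SumOfTwoSquares : ℕ → Set
SumOfTwoSquares D = ∃[ x ] ∃[ y ] (x ℤ.* x ℤ.+ y ℤ.* y ≡ + D)

two : ℚ
two = (+ 2) / 1

C-D : ℕ → Circle
C-D D = circle 1ℚ (0ℚ +i 0ℚ) (- ((+ D) / 1))

C-D1 : ℕ → Circle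
C-D1 D = circle two (1ℚ +i 0ℚ) (- (((+ D) ℤ.- (+ 1)) / 2))

C-D2 : ℕ → Circle
C-D2 D = circle two (0ℚ +i 1ℚ) (- (((+ D) ℤ.- (+ 1)) / 2))

C-D3 : ℕ → Circle
C-D3 D = circle two (1ℚ +i 1ℚ) (- (((+ D) ℤ.- (+ 2)) / 2))

data IsCircleOf (D : ℕ) : Circle → Set where
  isC-D  : IsCircleOf D (C-D D)
  isC-D1 : D % 4 ≡ 1 → IsCircleOf D (C-D1 D)
  isC-D2 : D % 4 ≡ 1 → IsCircleOf D (C-D2 D)
  isC-D3 : D % 4 ≡ 2 → IsCircleOf D (C-D3 D)

{-# OPTIONS --safe #-}
module Submission where

-- The map z ↦ z + 1 preserves the radius of a circle and moves its centre
-- by 1, and two circles of equal squared radius r at distance 1 cross iff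
-- (1 - 2r)² < 4r², i.e. iff r > 1/4.  The squared radius is D for C_D and
-- D/4 for the other three circles, so everything exceeds 1/4 once D ≥ 2;
-- the hypothesis that D is not a sum of two squares only rules out D = 1.

open import Defs
open import Data.Nat using (ℕ; suc; _≤_)
open import Relation.Nullary using (¬_)

open import Data.Nat.Properties using (≤∧≢⇒<)
open import Data.Integer as ℤ using (+_; +<+)
import Data.Integer.Properties as ℤ
import Data.Integer.Solver as ℤ-Solver
open import Data.Product using (_,_)
open import Data.Rational hiding (_≤_)
open import Data.Rational.Properties
import Data.Rational.Solver as ℚ-Solver
import Data.Rational.Unnormalised as ℚᵘ
import Data.Rational.Unnormalised.Properties as ℚᵘ
open import Relation.Binary.PropositionalEquality
open import Relation.Nullary.Decidable using (toWitness)

¼ : ℚ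
¼ = + 1 / 4

toℚᵘ-/ : ∀ i n → toℚᵘ (i / suc n) ℚᵘ.≃ ℚᵘ.mkℚᵘ i n
toℚᵘ-/ i n = toℚᵘ-fromℚᵘ (ℚᵘ.mkℚᵘ i n)

[i-j]/2≡[i/1-j/1]*½ : ∀ i j → (i ℤ.- j) / 2 ≡ (i / 1 - j / 1) * ½
[i-j]/2≡[i/1-j/1]*½ i j = toℚᵘ-injective (begin
  toℚᵘ ((i ℤ.- j) / 2)                         ≈⟨ toℚᵘ-/ (i ℤ.- j) 1 ⟩
  ℚᵘ.mkℚᵘ (i ℤ.- j) 1                          ≈⟨ ℚᵘ.*≡* cross-multiplied ⟩
  (ℚᵘ.mkℚᵘ i 0 ℚᵘ.- ℚᵘ.mkℚᵘ j 0) ℚᵘ.* ℚᵘ.½      ≈⟨ ℚᵘ.*-congʳ (ℚᵘ.+-cong (toℚᵘ-/ i 0)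
                                                                   (ℚᵘ.-‿cong (toℚᵘ-/ j 0))) ⟨
  (toℚᵘ (i / 1) ℚᵘ.- toℚᵘ (j / 1)) ℚᵘ.* ℚᵘ.½    ≈⟨ toℚᵘ-homo-- ⟨
  toℚᵘ ((i / 1 - j / 1) * ½)                   ∎)
  where
  open ℚᵘ.≃-Reasoning
  open ℤ-Solver.+-*-Solver
  cross-multiplied : (i ℤ.- j) ℤ.* + 2 ≡ ((i ℤ.* + 1 ℤ.+ ℤ.- j ℤ.* + 1) ℤ.* + 1) ℤ.* + 2
  cross-multiplied = solve 2 (λ i j → (i :- j) :* con (+ 2)
                                   := ((i :* con (+ 1) :+ (:- j) :* con (+ 1)) :* con (+ 1)) :* con (+ 2)) refl i j
  toℚᵘ-homo-- : toℚᵘ ((i / 1 - j / 1) * ½) ℚᵘ.≃ (toℚᵘ (i / 1) ℚᵘ.- toℚᵘ (j / 1)) ℚᵘ.* ℚᵘ.½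
  toℚᵘ-homo-- = ℚᵘ.≃-trans (toℚᵘ-homo-* (i / 1 - j / 1) ½)
    (ℚᵘ.*-congʳ (ℚᵘ.≃-trans (toℚᵘ-homo-+ (i / 1) (- (j / 1)))
                            (ℚᵘ.+-congʳ (toℚᵘ (i / 1)) (toℚᵘ-homo‿- (j / 1)))))

/1-mono-< : ∀ {i j} → i ℤ.< j → i / 1 < j / 1
/1-mono-< {i} {j} i<j = toℚᵘ-cancel-<
  (ℚᵘ.<-respˡ-≃ (ℚᵘ.≃-sym (toℚᵘ-/ i 0)) (ℚᵘ.<-respʳ-≃ (ℚᵘ.≃-sym (toℚᵘ-/ j 0))
    (ℚᵘ.*<* (subst₂ ℤ._<_ (sym (ℤ.*-identityʳ i)) (sym (ℤ.*-identityʳ j)) i<j))))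

radiusSq-translate1 : ∀ C → radiusSq (translate1 C) ≡ radiusSq C
radiusSq-translate1 (circle a (x +i y) c) = cong (λ t → (t ÷ a) ÷ a)
  (solve 4 (λ a x y c → (x :- a) :* (x :- a) :+ y :* y :- a :* (c :+ a :- (x :+ x))
                      := x :* x :+ y :* y :- a :* c) refl a x y c)
  where open ℚ-Solver.+-*-Solver

centre-translate1 : ∀ C → centre (translate1 C) -ᶜ centre C ≡ 1ℚ +i 0ℚ
centre-translate1 (circle a (x +i y) c) = cong₂ _+i_ re≡1 (+-inverseʳ (y ÷ a))
  where
  open ℚ-Solver.+-*-Solver
  re≡1 : - ((x - a) ÷ a) - - (x ÷ a) ≡ 1ℚ
  re≡1 = trans (solve 3 (λ x a a⁻¹ → :- ((x :- a) :* a⁻¹) :- :- (x :* a⁻¹) := a :* a⁻¹) refl x a (1/ a))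
               (*-inverseʳ a)

¼<r⇒[1-2r]²<4r² : ∀ {r} → ¼ < r → (1ℚ - r - r) * (1ℚ - r - r) < (+ 4 / 1) * r * r
¼<r⇒[1-2r]²<4r² {r} ¼<r = begin-strict
  x                        ≡⟨ solve 1 (λ x → x := (x :- con 1ℚ) :+ con 1ℚ) refl x ⟩
  (x - 1ℚ) + 1ℚ            <⟨ +-monoʳ-< (x - 1ℚ) (*-monoʳ-<-pos (+ 4 / 1) ¼<r) ⟩
  (x - 1ℚ) + + 4 / 1 * r   ≡⟨ solve 1 (λ r → let y = con 1ℚ :- r :- r in
                                  (y :* y :- con 1ℚ) :+ con (+ 4 / 1) :* r := con (+ 4 / 1) :* r :* r) refl r ⟩
  + 4 / 1 * r * r          ∎
  where
  open ≤-Reasoning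
  open ℚ-Solver.+-*-Solver
  x = (1ℚ - r - r) * (1ℚ - r - r)

equalRadii∧unitDistance⇒Crosses : ∀ {C C'} → radiusSq C ≡ radiusSq C' →
  normSq (centre C -ᶜ centre C') ≡ 1ℚ → ¼ < radiusSq C → Crosses C C'
equalRadii∧unitDistance⇒Crosses R≡S d²≡1 ¼<R rewrite sym R≡S | d²≡1 =
  0<R , 0<R , ¼<r⇒[1-2r]²<4r² ¼<R
  where 0<R = <-trans (positive⁻¹ ¼) ¼<R

translate1-Crosses : ∀ C → ¼ < radiusSq C → Crosses (translate1 C) C
translate1-Crosses C ¼<R =
  equalRadii∧unitDistance⇒Crosses {translate1 C} {C} (radiusSq-translate1 C) (cong normSq (centre-translate1 C))
    (subst (¼ <_) (sym (radiusSq-translate1 C)) ¼<R)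

radiusSq-C-D : ∀ D → radiusSq (C-D D) ≡ + D / 1
radiusSq-C-D D =
  solve 1 (λ d → ((con 0ℚ :* con 0ℚ :+ con 0ℚ :* con 0ℚ :- con 1ℚ :* (:- d)) :* con 1ℚ) :* con 1ℚ := d) refl (+ D / 1)
  where open ℚ-Solver.+-*-Solver

-- C_{D,1}, C_{D,2} and C_{D,3} all have the shape 2|z|² + bz + b̄z̄ - (D - |b|²)/2.
radiusSq-circle-two : ∀ b i j → j / 1 ≡ normSq b →
  radiusSq (circle two b (- ((i ℤ.- j) / 2))) ≡ i / 1 * ¼
radiusSq-circle-two b i j j≡|b|² = begin
  radiusSq (circle two b (- ((i ℤ.- j) / 2)))
    ≡⟨ cong (λ q → radiusSq (circle two b (- q))) ([i-j]/2≡[i/1-j/1]*½ i j) ⟩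
  radiusSq (circle two b (- ((i / 1 - j / 1) * ½)))
    ≡⟨ cong (λ n → radiusSq (circle two b (- ((i / 1 - n) * ½)))) j≡|b|² ⟩
  radiusSq (circle two b (- ((i / 1 - normSq b) * ½)))
    ≡⟨ solve 2 (λ n q → ((n :- con two :* (:- ((q :- n) :* con ½))) :* con ½) :* con ½ := q :* con ¼)
               refl (normSq b) (i / 1) ⟩
  i / 1 * ¼
    ∎
  where
  open ≡-Reasoning
  open ℚ-Solver.+-*-Solver

2≤n⇒1<n/1 : ∀ {n} → 2 ≤ n → 1ℚ < + n / 1
2≤n⇒1<n/1 2≤n = /1-mono-< (+<+ 2≤n)

¼<n/1*¼ : ∀ {n} → 2 ≤ n → ¼ < + n / 1 * ¼
¼<n/1*¼ 2≤n = *-monoˡ-<-pos ¼ (2≤n⇒1<n/1 2≤n)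

¼<radiusSq : ∀ {D C} → 2 ≤ D → IsCircleOf D C → ¼ < radiusSq C
¼<radiusSq {D} 2≤D isC-D      = subst (¼ <_) (sym (radiusSq-C-D D))
  (<-trans (toWitness {a? = ¼ <? 1ℚ} _) (2≤n⇒1<n/1 2≤D))
¼<radiusSq {D} 2≤D (isC-D1 _) = subst (¼ <_) (sym (radiusSq-circle-two (1ℚ +i 0ℚ) (+ D) (+ 1) refl)) (¼<n/1*¼ 2≤D)
¼<radiusSq {D} 2≤D (isC-D2 _) = subst (¼ <_) (sym (radiusSq-circle-two (0ℚ +i 1ℚ) (+ D) (+ 1) refl)) (¼<n/1*¼ 2≤D)
¼<radiusSq {D} 2≤D (isC-D3 _) = subst (¼ <_) (sym (radiusSq-circle-two (1ℚ +i 1ℚ) (+ D) (+ 2) refl)) (¼<n/1*¼ 2≤D)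

sumOfTwoSquares-1 : SumOfTwoSquares 1
sumOfTwoSquares-1 = + 1 , + 0 , refl

lemma7p3 : (D : ℕ) → 1 ≤ D → ¬ SumOfTwoSquares D →
    (C : Circle) → IsCircleOf D C → Crosses (translate1 C) C
lemma7p3 D 1≤D ¬□ C isC = translate1-Crosses C (¼<radiusSq 2≤D isC)
  where
  2≤D : 2 ≤ D
  2≤D = ≤∧≢⇒< 1≤D (λ 1≡D → ¬□ (subst SumOfTwoSquares 1≡D sumOfTwoSquares-1))
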